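{- Let $\Gamma\subset\Sigma_8$ be the finite set \[ \Gamma=\{(-3)_0,(-3)_2,(-2)_0,(-2)_1,(-2)_2,(-2)_3,(-2)_5,(-2)_7,(-1)_1,(-1)_3,(-1)_4,(-1)_5,(-1)_6,(-1)_7,0_4,0_6\}. \] If $w$ is a pre-$5/4$-power-free subscript-increasing word over $\Sigma_8\setminus\Gamma$, then $\varphi(w)$ is pre-$5/4$-power-free.
   Context: Let $\Sigma_8=\{n_j : n\in\mathbb{Z},\ 0\le j\le 7\}$ be the infinite alphabet of distinct formal symbols $n_j$. Let $\varphi$ be the $6$-uniform morphism on $\Sigma_8$ (extended to finite and infinite words by concatenation) defined for all $n\in\mathbb{Z}$ by $\varphi(n_0)=0_0 1_1 0_2 0_3 1_4 (n+3)_5$, $\varphi(n_1)=1_6 1_7 0_0 0_1 0_2 (n+2)_3$, $\varphi(n_2)=1_4 1_5 1_6 0_7 0_0 (n+3)_1$, $\varphi(n_3)=0_2 1_3 1_4 0_5 1_6 (n+2)_7$, $\varphi(n_4)=0_0 1_1 0_2 0_3 1_4 (n+1)_5$, $\varphi(n_5)=1_6 1_7 0_0 0_1 0_2 (n+2)_3$, $\varphi(n_6)=1_4 1_5 1_6 0_7 0_0 (n+1)_1$, $\varphi(n_7)=0_2 1_3 1_4 0_5 1_6 (n+2)_7$. Words may be finite or infinite. A word over $\Sigma_8$ is subscript-increasing if the subscripts of consecutive letters increase by $1$ modulo $8$. A $5/4$-power is a word $xyx$ with $|x|\ge1$ and $|y|=3|x|$. A word $v$ over $\Sigma_8$ is a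 pre-$5/4$-power if $\varphi(v)$ is a $5/4$-power; a word is pre-$5/4$-power-free if none of its factors is a pre-$5/4$-power. -}

module Defs where

open import Data.Nat as ℕ using (ℕ; zero; suc; _≥_; _/_; _%_)
open import Data.Nat.DivMod using (m%n<n)
open import Data.Integer as ℤ using (ℤ; +_; -[1+_])
open import Data.Fin as Fin using (Fin; toℕ; fromℕ<; #_)
open import Data.Product using (_×_; _,_; Σ; ∃; ∃-syntax; proj₂)
open import Data.List as List using (List; []; _∷_; _++_; length; concatMap; map; upTo)
open import Data.List.Membership.Propositional using (_∉_)
open import Data.List.Relation.Unary.All using (All)
open import Data.List.Relation.Unary.Linked using (Linked)
open import Data.Vec as Vec using (Vec; []; _∷_)
open import Relation.Binary.PropositionalEquality using (_≡_)
open import Relation.Nullary using (¬_)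

-- The letter n_j is the pair (n , j).
Letter : Set
Letter = ℤ × Fin 8

sub : Letter → Fin 8
sub = proj₂

_⟨_⟩ : ℤ → Fin 8 → Letter
n ⟨ j ⟩ = n , j

Word : Set
Word = List Letter

ωWord : Set
ωWord = ℕ → Letter

z0 z1 : ℤ
z0 = + 0
z1 = + 1

φᵥ : Letter → Vec Letter 6
φᵥ (n , j) with toℕ j
... | 0 = z0 ⟨ # 0 ⟩ ∷ z1 ⟨ # 1 ⟩ ∷ z0 ⟨ # 2 ⟩ ∷ z0 ⟨ # 3 ⟩ ∷ z1 ⟨ # 4 ⟩ ∷ (n ℤ.+ + 3) ⟨ # 5 ⟩ ∷ []
... | 1 = z1 ⟨ # 6 ⟩ ∷ z1 ⟨ # 7 ⟩ ∷ z0 ⟨ # 0 ⟩ ∷ z0 ⟨ # 1 ⟩ ∷ z0 ⟨ # 2 ⟩ ∷ (n ℤ.+ + 2) ⟨ # 3 ⟩ ∷ []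
... | 2 = z1 ⟨ # 4 ⟩ ∷ z1 ⟨ # 5 ⟩ ∷ z1 ⟨ # 6 ⟩ ∷ z0 ⟨ # 7 ⟩ ∷ z0 ⟨ # 0 ⟩ ∷ (n ℤ.+ + 3) ⟨ # 1 ⟩ ∷ []
... | 3 = z0 ⟨ # 2 ⟩ ∷ z1 ⟨ # 3 ⟩ ∷ z1 ⟨ # 4 ⟩ ∷ z0 ⟨ # 5 ⟩ ∷ z1 ⟨ # 6 ⟩ ∷ (n ℤ.+ + 2) ⟨ # 7 ⟩ ∷ []
... | 4 = z0 ⟨ # 0 ⟩ ∷ z1 ⟨ # 1 ⟩ ∷ z0 ⟨ # 2 ⟩ ∷ z0 ⟨ # 3 ⟩ ∷ z1 ⟨ # 4 ⟩ ∷ (n ℤ.+ + 1) ⟨ # 5 ⟩ ∷ []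
... | 5 = z1 ⟨ # 6 ⟩ ∷ z1 ⟨ # 7 ⟩ ∷ z0 ⟨ # 0 ⟩ ∷ z0 ⟨ # 1 ⟩ ∷ z0 ⟨ # 2 ⟩ ∷ (n ℤ.+ + 2) ⟨ # 3 ⟩ ∷ []
... | 6 = z1 ⟨ # 4 ⟩ ∷ z1 ⟨ # 5 ⟩ ∷ z1 ⟨ # 6 ⟩ ∷ z0 ⟨ # 7 ⟩ ∷ z0 ⟨ # 0 ⟩ ∷ (n ℤ.+ + 1) ⟨ # 1 ⟩ ∷ []
... | _ = z0 ⟨ # 2 ⟩ ∷ z1 ⟨ # 3 ⟩ ∷ z1 ⟨ # 4 ⟩ ∷ z0 ⟨ # 5 ⟩ ∷ z1 ⟨ # 6 ⟩ ∷ (n ℤ.+ + 2) ⟨ # 7 ⟩ ∷ []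
-- (the last clause is j = 7, the only remaining value since j : Fin 8)

φ : Word → Word
φ = concatMap (λ a → Vec.toList (φᵥ a))

φω : ωWord → ωWord
φω s i = Vec.lookup (φᵥ (s (i / 6))) (fromℕ< (m%n<n i 6))

Is5/4Power : Word → Set
Is5/4Power u = ∃[ x ] ∃[ y ] (u ≡ x ++ y ++ x × length x ≥ 1 × length y ≡ 3 ℕ.* length x)

IsPre5/4Power : Word → Set
IsPre5/4Power v = Is5/4Power (φ v)

Factor : Word → Word → Set
Factor v w = ∃[ p ] ∃[ q ] (w ≡ p ++ v ++ q)

segment : ωWord → ℕ → ℕ → Word
segment s i n = map (λ k → s (i ℕ.+ k)) (upTo n)

Factorω : Word → ωWord → Set
Factorω v s = ∃[ i ] (v ≡ segment s i (length v))

Pre5/4PowerFree : Word → Set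
Pre5/4PowerFree w = ∀ v → Factor v w → ¬ IsPre5/4Power v

Pre5/4PowerFreeω : ωWord → Set
Pre5/4PowerFreeω s = ∀ v → Factorω v s → ¬ IsPre5/4Power v

Succ8 : Letter → Letter → Set
Succ8 a b = toℕ (sub b) ≡ (suc (toℕ (sub a))) % 8

SubscriptIncreasing : Word → Set
SubscriptIncreasing = Linked Succ8

SubscriptIncreasingω : ωWord → Set
SubscriptIncreasingω s = ∀ i → Succ8 (s i) (s (suc i))

m1 m2 m3 : ℤ
m1 = -[1+ 0 ]
m2 = -[1+ 1 ]
m3 = -[1+ 2 ]

Γ : List Letter
Γ = m3 ⟨ # 0 ⟩ ∷ m3 ⟨ # 2 ⟩ ∷ m2 ⟨ # 0 ⟩ ∷ m2 ⟨ # 1 ⟩ ∷ m2 ⟨ # 2 ⟩ ∷ m2 ⟨ # 3 ⟩ ∷ m2 ⟨ # 5 ⟩ ∷ m2 ⟨ # 7 ⟩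
  ∷ m1 ⟨ # 1 ⟩ ∷ m1 ⟨ # 3 ⟩ ∷ m1 ⟨ # 4 ⟩ ∷ m1 ⟨ # 5 ⟩ ∷ m1 ⟨ # 6 ⟩ ∷ m1 ⟨ # 7 ⟩ ∷ z0 ⟨ # 4 ⟩ ∷ z0 ⟨ # 6 ⟩ ∷ List.[]

AvoidsΓ : Word → Set
AvoidsΓ = All (_∉ Γ)

AvoidsΓω : ωWord → Set
AvoidsΓω s = ∀ i → s i ∉ Γ

-- Let v be a factor of φ(w) with φ(v) = xyx, |y| = 3|x|. Since 6|v| = 5|x| and gcd(5,6) = 1, |v| = 5k and
-- |x| = 6k; as φ(a) is determined by its last letter φlast(a), φ(v) is a 5/4-power exactly when
-- φlast(v_i) = φlast(v_(4k+i)) for all i < k. Each letter of φ(w) is either determined by the subscript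
-- of its block letter a and its offset in the block, or is φlast(a), where φlast(n_j) = (n + c_j)_(s_j).
-- If 6 divides k, the compared letters are last letters of blocks whose subscripts differ by a multiple
-- of 4; s_j has period 4 and φlast is injective on letters of equal subscript, so the comparisons
-- descend to a pre-5/4-power of length 5k/6 in w. Otherwise, w being subscript-increasing, the pair
-- (subscript, offset) follows a 48-periodic automaton, so only k mod 12 and the starting state matter,
-- and an exhaustive check finds in each case a compared pair whose letters can agree only if some
-- letter of w lies in Γ.

module Submission where

open import Defs
open import Data.Product using (_×_; _,_; proj₁; proj₂; ∃; ∃-syntax)
open import Data.Product.Properties using (≡-dec)
open import Data.Sum using (_⊎_; inj₁; inj₂; [_,_]′)
open import Data.Empty using (⊥; ⊥-elim)
open import Data.Nat as ℕ using (ℕ; zero; suc; _+_; _*_; _∸_; _≤_; _<_; _≥_; s≤s; z≤n; _/_; _%_)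
open import Data.Nat.Properties
open import Data.Nat.DivMod
open import Data.Nat.Divisibility using (_∣_; divides; divides-refl; module _∣_)
open import Data.Nat.Coprimality using (coprime?; coprime-divisor)
open import Data.Nat.GeneralisedArithmetic using (fold; fold-+)
open import Data.Nat.Tactic.RingSolver using (solve-∀)
open import Data.Integer as ℤ using (ℤ)
import Data.Integer.Properties as ℤ
open import Data.Fin as Fin using (Fin; toℕ; #_)
open import Data.Fin.Patterns using (0F; 1F; 2F; 3F; 4F; 5F; 6F; 7F)
import Data.Fin.Properties as Fin
open import Data.List as List using (List; []; _∷_; _++_; length; applyUpTo)
import Data.List.Properties as List
open import Data.List.Relation.Unary.All using (All; _∷_)
open import Data.List.Relation.Unary.Linked using (Linked; [-]; _∷_)
open import Data.List.Membership.Propositional using (_∈_; _∉_)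
open import Data.Vec as Vec using (Vec; updateAt)
import Data.Vec.Properties as Vec
open import Function using (_∘_; const)
open import Algebra.Bundles using (AbelianGroup)
open import Algebra.Properties.Group (AbelianGroup.group ℤ.+-0-abelianGroup) using (x≈z//y)
open import Relation.Binary.Definitions using (DecidableEquality)
open import Relation.Binary.PropositionalEquality
open import Relation.Nullary using (¬_; Dec; yes; no)
open import Relation.Nullary.Decidable using (from-yes; toWitness; ¬?; _→-dec_; _⊎-dec_)

open _∣_ using (quotient; equality)

private variable A : Set

applyUpTo-++ : ∀ (f : ℕ → A) m n → applyUpTo f (m + n) ≡ applyUpTo f m ++ applyUpTo (f ∘ (m +_)) n
applyUpTo-++ f zero    n = refl
applyUpTo-++ f (suc m) n = cong (f 0 ∷_) (applyUpTo-++ (f ∘ suc) m n)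

applyUpTo-cong : ∀ {f g : ℕ → A} n → (∀ i → i < n → f i ≡ g i) → applyUpTo f n ≡ applyUpTo g n
applyUpTo-cong zero    _   = refl
applyUpTo-cong (suc n) f≗g = cong₂ _∷_ (f≗g 0 (s≤s z≤n)) (applyUpTo-cong n (λ i i<n → f≗g (suc i) (s≤s i<n)))

applyUpTo-injective : ∀ {f g : ℕ → A} n → applyUpTo f n ≡ applyUpTo g n → ∀ i → i < n → f i ≡ g i
applyUpTo-injective (suc n) eq zero    _         = List.∷-injectiveˡ eq
applyUpTo-injective (suc n) eq (suc i) (s≤s i<n) = applyUpTo-injective n (List.∷-injectiveʳ eq) i i<n

++-injective : ∀ (xs xs′ : List A) {ys ys′} → length xs ≡ length xs′ → xs ++ ys ≡ xs′ ++ ys′ → xs ≡ xs′ × ys ≡ ys′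
++-injective []       []         _         eq = refl , eq
++-injective (x ∷ xs) (x′ ∷ xs′) ∣xs∣≡∣xs′∣ eq =
  let xs≡xs′ , ys≡ys′ = ++-injective xs xs′ (suc-injective ∣xs∣≡∣xs′∣) (List.∷-injectiveʳ eq)
  in cong₂ _∷_ (List.∷-injectiveˡ eq) xs≡xs′ , ys≡ys′

applyUpTo-split : ∀ (f : ℕ → A) n xs ys → applyUpTo f n ≡ xs ++ ys →
                  applyUpTo f (length xs) ≡ xs × applyUpTo (f ∘ (length xs +_)) (length ys) ≡ ys
applyUpTo-split f n xs ys eq = ++-injective _ xs (List.length-applyUpTo f (length xs)) (begin
  applyUpTo f (length xs) ++ applyUpTo (f ∘ (length xs +_)) (length ys) ≡⟨ applyUpTo-++ f (length xs) (length ys) ⟨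
  applyUpTo f (length xs + length ys)                                   ≡⟨ cong (applyUpTo f) n≡∣xs∣+∣ys∣ ⟨
  applyUpTo f n                                                         ≡⟨ eq ⟩
  xs ++ ys                                                              ∎)
  where
  open ≡-Reasoning
  n≡∣xs∣+∣ys∣ : n ≡ length xs + length ys
  n≡∣xs∣+∣ys∣ = trans (sym (List.length-applyUpTo f n)) (trans (cong length eq) (List.length-++ xs))

applyUpTo-factor : ∀ (f : ℕ → A) n us vs ws → applyUpTo f n ≡ us ++ vs ++ ws →
                   applyUpTo (f ∘ (length us +_)) (length vs) ≡ vs × length us + length vs ≤ n
applyUpTo-factor f n us vs ws eq =
  proj₁ (applyUpTo-split (f ∘ (length us +_)) _ vs ws (proj₂ (applyUpTo-split f n us (vs ++ ws) eq))) ,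
  (begin
    length us + length vs                 ≤⟨ +-monoʳ-≤ (length us) (m≤m+n (length vs) (length ws)) ⟩
    length us + (length vs + length ws)   ≡⟨ cong (length us +_) (List.length-++ vs) ⟨
    length us + length (vs ++ ws)         ≡⟨ List.length-++ us ⟨
    length (us ++ vs ++ ws)               ≡⟨ cong length eq ⟨
    length (applyUpTo f n)                ≡⟨ List.length-applyUpTo f n ⟩
    n                                     ∎)
  where open ≤-Reasoning

fold-*-invariant : ∀ {B : Set} (h : A → B) (f : A → A) p → (∀ x → h (fold x f p) ≡ h x) →
                   ∀ q x → h (fold x f (q * p)) ≡ h x
fold-*-invariant h f p inv zero    x = refl
fold-*-invariant h f p inv (suc q) x = begin
  h (fold x f (p + q * p))        ≡⟨ cong h (fold-+ x f p) ⟩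
  h (fold (fold x f (q * p)) f p) ≡⟨ inv _ ⟩
  h (fold x f (q * p))            ≡⟨ fold-*-invariant h f p inv q x ⟩
  h x                             ∎
  where open ≡-Reasoning

-- The image of a single letter

infixr 6 _+ₗ_
_+ₗ_ : ℤ → Letter → Letter
n +ₗ (m , j) = n ℤ.+ m , j

φlast : Letter → Letter
φlast a = Vec.lookup (φᵥ a) (# 5)

φlast-+ₗ : ∀ n j → φlast (n , j) ≡ n +ₗ φlast (z0 , j)
φlast-+ₗ n 0F = refl
φlast-+ₗ n 1F = refl
φlast-+ₗ n 2F = refl
φlast-+ₗ n 3F = refl
φlast-+ₗ n 4F = refl
φlast-+ₗ n 5F = refl
φlast-+ₗ n 6F = refl
φlast-+ₗ n 7F = refl

φlast-equivariant : ∀ n a → φlast (n +ₗ a) ≡ n +ₗ φlast a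
φlast-equivariant n (m , j) = begin
  φlast (n ℤ.+ m , j)         ≡⟨ φlast-+ₗ (n ℤ.+ m) j ⟩
  (n ℤ.+ m) +ₗ φlast (z0 , j) ≡⟨ cong (_, _) (ℤ.+-assoc n m _) ⟩
  n +ₗ m +ₗ φlast (z0 , j)    ≡⟨ cong (n +ₗ_) (φlast-+ₗ m j) ⟨
  n +ₗ φlast (m , j)          ∎
  where open ≡-Reasoning

φlast²-+ₗ : ∀ n j → φlast (φlast (n , j)) ≡ n +ₗ φlast (φlast (z0 , j))
φlast²-+ₗ n j = trans (cong φlast (φlast-+ₗ n j)) (φlast-equivariant n (φlast (z0 , j)))

+ₗ-cancelʳ : ∀ {n n′} ℓ → n +ₗ ℓ ≡ n′ +ₗ ℓ → n ≡ n′
+ₗ-cancelʳ {n} {n′} (m , _) eq = trans (x≈z//y n m _ (cong proj₁ eq)) (sym (x≈z//y n′ m _ refl))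

φlast-injective : ∀ {a b} → sub a ≡ sub b → φlast a ≡ φlast b → a ≡ b
φlast-injective {n , j} {n′ , .j} refl eq =
  cong (_, j) (+ₗ-cancelʳ (φlast (z0 , j)) (trans (sym (φlast-+ₗ n j)) (trans eq (φlast-+ₗ n′ j))))

-- The subscript of φlast(n_j) determines j modulo 4, and with it the first five letters of φ(n_j).
origin : Fin 8 → Fin 8
origin s with toℕ s
... | 5 = 0F
... | 3 = 1F
... | 1 = 2F
... | _ = 3F

φᵥ-by-last : ∀ a → φᵥ a ≡ updateAt (φᵥ (z0 , origin (sub (φlast a)))) (# 5) (const (φlast a))
φᵥ-by-last (n , 0F) = refl
φᵥ-by-last (n , 1F) = refl
φᵥ-by-last (n , 2F) = refl
φᵥ-by-last (n , 3F) = refl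
φᵥ-by-last (n , 4F) = refl
φᵥ-by-last (n , 5F) = refl
φᵥ-by-last (n , 6F) = refl
φᵥ-by-last (n , 7F) = refl

φᵥ-determined-by-last : ∀ {a b} → φlast a ≡ φlast b → φᵥ a ≡ φᵥ b
φᵥ-determined-by-last {a} {b} eq = begin
  φᵥ a                                                                ≡⟨ φᵥ-by-last a ⟩
  updateAt (φᵥ (z0 , origin (sub (φlast a)))) (# 5) (const (φlast a)) ≡⟨ cong (λ ℓ → updateAt (φᵥ (z0 , origin (sub ℓ))) (# 5) (const ℓ)) eq ⟩
  updateAt (φᵥ (z0 , origin (sub (φlast b)))) (# 5) (const (φlast b)) ≡⟨ φᵥ-by-last b ⟨
  φᵥ b                                                                ∎
  where open ≡-Reasoning

lookup-φᵥ-≢5 : ∀ a r → r ≢ # 5 → Vec.lookup (φᵥ a) r ≡ Vec.lookup (φᵥ (z0 , origin (sub (φlast a)))) r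
lookup-φᵥ-≢5 a r r≢5 =
  trans (cong (λ v → Vec.lookup v r) (φᵥ-by-last a)) (Vec.lookup∘updateAt′ r (# 5) r≢5 (φᵥ (z0 , origin (sub (φlast a)))))

φᵥ-fixed : ∀ n j r → r ≢ # 5 → Vec.lookup (φᵥ (n , j)) r ≡ Vec.lookup (φᵥ (z0 , j)) r
φᵥ-fixed n j r r≢5 = begin
  Vec.lookup (φᵥ (n , j)) r                              ≡⟨ lookup-φᵥ-≢5 (n , j) r r≢5 ⟩
  Vec.lookup (φᵥ (z0 , origin (sub (φlast (n , j))))) r  ≡⟨ cong (λ ℓ → Vec.lookup (φᵥ (z0 , origin (sub ℓ))) r) (φlast-+ₗ n j) ⟩
  Vec.lookup (φᵥ (z0 , origin (sub (φlast (z0 , j))))) r ≡⟨ lookup-φᵥ-≢5 (z0 , j) r r≢5 ⟨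
  Vec.lookup (φᵥ (z0 , j)) r                             ∎
  where open ≡-Reasoning

-- Positions in an image: block and offset

Block : Set
Block = ℕ × Fin 6

blockOf : ℕ → Block
blockOf q = q / 6 , q mod 6

position : Block → ℕ
position (c , r) = c * 6 + toℕ r

-- By definition, φω h q is letterAt h (blockOf q).
letterAt : (ℕ → Letter) → Block → Letter
letterAt h (c , r) = Vec.lookup (φᵥ (h c)) r

blockOf-+ : ∀ c q → blockOf (c * 6 + q) ≡ (c + q / 6 , q mod 6)
blockOf-+ c q = cong₂ _,_
  (trans (+-distrib-/-∣ˡ q (divides-refl c)) (cong (_+ q / 6) (m*n/n≡m c 6)))
  (Fin.fromℕ<-cong _ _ (%-remove-+ˡ q (divides-refl c)) (m%n<n (c * 6 + q) 6) (m%n<n q 6))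

blockOf-position : ∀ b → blockOf (position b) ≡ b
blockOf-position (c , r) = trans (blockOf-+ c (toℕ r)) (cong₂ _,_
  (trans (cong (c +_) (m<n⇒m/n≡0 (Fin.toℕ<n r))) (+-identityʳ c))
  (trans (Fin.fromℕ<-cong _ _ (m<n⇒m%n≡m (Fin.toℕ<n r)) _ (Fin.toℕ<n r)) (Fin.fromℕ<-toℕ r (Fin.toℕ<n r))))

position-blockOf : ∀ q → position (blockOf q) ≡ q
position-blockOf q = trans (+-comm (q / 6 * 6) _) (sym (DivMod.property (q divMod 6)))

position-< : ∀ {c N} r → c < N → position (c , r) < N * 6
position-< {c} {N} r c<N = begin-strict
  c * 6 + toℕ r <⟨ +-monoʳ-< (c * 6) (Fin.toℕ<n r) ⟩
  c * 6 + 6     ≡⟨ +-comm (c * 6) 6 ⟩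
  suc c * 6     ≤⟨ *-monoˡ-≤ 6 c<N ⟩
  N * 6         ∎
  where open ≤-Reasoning

φω-shift : ∀ h c q → φω h (c * 6 + q) ≡ φω (h ∘ (c +_)) q
φω-shift h c q = cong (letterAt h) (blockOf-+ c q)

φω-position : ∀ h b → φω h (position b) ≡ letterAt h b
φω-position h b = cong (letterAt h) (blockOf-position b)

toList≡applyUpTo-lookup : ∀ (v : Vec A 6) → Vec.toList v ≡ applyUpTo (λ q → Vec.lookup v (q mod 6)) 6
toList≡applyUpTo-lookup (_ Vec.∷ _ Vec.∷ _ Vec.∷ _ Vec.∷ _ Vec.∷ _ Vec.∷ Vec.[]) = refl

φ-applyUpTo : ∀ h n → φ (applyUpTo h n) ≡ applyUpTo (φω h) (n * 6)
φ-applyUpTo h zero    = refl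
φ-applyUpTo h (suc n) = begin
  Vec.toList (φᵥ (h 0)) ++ φ (applyUpTo (h ∘ suc) n)    ≡⟨ cong₂ _++_ (toList≡applyUpTo-lookup (φᵥ (h 0))) (φ-applyUpTo (h ∘ suc) n) ⟩
  applyUpTo (φω h) 6 ++ applyUpTo (φω (h ∘ suc)) (n * 6) ≡⟨ cong (applyUpTo (φω h) 6 ++_) (applyUpTo-cong (n * 6) (λ q _ → sym (φω-shift h 1 q))) ⟩
  applyUpTo (φω h) 6 ++ applyUpTo (φω h ∘ (6 +_)) (n * 6) ≡⟨ applyUpTo-++ (φω h) 6 (n * 6) ⟨
  applyUpTo (φω h) (suc n * 6)                           ∎
  where open ≡-Reasoning

tick : (A → A) → A × Fin 6 → A × Fin 6
tick f (a , 0F) = a , 1F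
tick f (a , 1F) = a , 2F
tick f (a , 2F) = a , 3F
tick f (a , 3F) = a , 4F
tick f (a , 4F) = a , 5F
tick f (a , 5F) = f a , 0F

position-tick : ∀ b → position (tick suc b) ≡ suc (position b)
position-tick (c , 0F) = +-suc (c * 6) 0
position-tick (c , 1F) = +-suc (c * 6) 1
position-tick (c , 2F) = +-suc (c * 6) 2
position-tick (c , 3F) = +-suc (c * 6) 3
position-tick (c , 4F) = +-suc (c * 6) 4
position-tick (c , 5F) = trans (+-identityʳ (6 + c * 6)) (trans (+-comm 6 (c * 6)) (+-suc (c * 6) 5))

blockOf-suc : ∀ q → blockOf (suc q) ≡ tick suc (blockOf q)
blockOf-suc q = begin
  blockOf (suc q)                           ≡⟨ cong (blockOf ∘ suc) (position-blockOf q) ⟨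
  blockOf (suc (position (blockOf q)))      ≡⟨ cong blockOf (position-tick (blockOf q)) ⟨
  blockOf (position (tick suc (blockOf q))) ≡⟨ blockOf-position _ ⟩
  tick suc (blockOf q)                      ∎
  where open ≡-Reasoning

-- Pre-5/4-powers

Echo : (ℕ → Letter) → ℕ → Set
Echo h k = ∀ i → i < k → φlast (h i) ≡ φlast (h (4 * k + i))

length-φ-applyUpTo : ∀ h n → length (φ (applyUpTo h n)) ≡ n * 6
length-φ-applyUpTo h n = trans (cong length (φ-applyUpTo h n)) (List.length-applyUpTo (φω h) (n * 6))

φ-++ : ∀ xs ys → φ (xs ++ ys) ≡ φ xs ++ φ ys
φ-++ = List.concatMap-++ (Vec.toList ∘ φᵥ)

φ-applyUpTo-cong : ∀ {f g} n → (∀ i → i < n → φlast (f i) ≡ φlast (g i)) → φ (applyUpTo f n) ≡ φ (applyUpTo g n)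
φ-applyUpTo-cong {f} {g} n same-last = cong List.concat (begin
  List.map (Vec.toList ∘ φᵥ) (applyUpTo f n) ≡⟨ List.map-applyUpTo f _ n ⟩
  applyUpTo (Vec.toList ∘ φᵥ ∘ f) n          ≡⟨ applyUpTo-cong n (λ i i<n → cong Vec.toList (φᵥ-determined-by-last (same-last i i<n))) ⟩
  applyUpTo (Vec.toList ∘ φᵥ ∘ g) n          ≡⟨ List.map-applyUpTo g _ n ⟨
  List.map (Vec.toList ∘ φᵥ) (applyUpTo g n) ∎)
  where open ≡-Reasoning

echo⇒pre5/4Power : ∀ h k → 1 ≤ k → Echo h k → IsPre5/4Power (applyUpTo h (5 * k))
echo⇒pre5/4Power h k k≥1 echo = x , y , φ-window , ∣x∣≥1 , ∣y∣≡3∣x∣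
  where
  x = φ (applyUpTo h k)
  y = φ (applyUpTo (h ∘ (k +_)) (3 * k))
  five-parts : ∀ k → 5 * k ≡ k + (3 * k + k)
  five-parts = solve-∀
  shift : ∀ k i → k + (3 * k + i) ≡ 4 * k + i
  shift = solve-∀
  φ-window : φ (applyUpTo h (5 * k)) ≡ x ++ y ++ x
  φ-window = begin
    φ (applyUpTo h (5 * k))
      ≡⟨ cong (φ ∘ applyUpTo h) (five-parts k) ⟩
    φ (applyUpTo h (k + (3 * k + k)))
      ≡⟨ cong φ (trans (applyUpTo-++ h k _) (cong (applyUpTo h k ++_) (applyUpTo-++ (h ∘ (k +_)) (3 * k) k))) ⟩
    φ (applyUpTo h k ++ applyUpTo (h ∘ (k +_)) (3 * k) ++ applyUpTo (λ i → h (k + (3 * k + i))) k)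
      ≡⟨ trans (φ-++ (applyUpTo h k) _) (cong (x ++_) (φ-++ (applyUpTo (h ∘ (k +_)) (3 * k)) _)) ⟩
    x ++ y ++ φ (applyUpTo (λ i → h (k + (3 * k + i))) k)
      ≡⟨ cong (λ z → x ++ y ++ z) (φ-applyUpTo-cong k (λ i i<k → sym (trans (echo i i<k) (cong (φlast ∘ h) (sym (shift k i)))))) ⟩
    x ++ y ++ x
      ∎
    where open ≡-Reasoning
  ∣x∣≥1 : length x ≥ 1
  ∣x∣≥1 = subst (1 ≤_) (sym (length-φ-applyUpTo h k)) (≤-trans k≥1 (m≤m*n k 6))
  ∣y∣≡3∣x∣ : length y ≡ 3 * length x
  ∣y∣≡3∣x∣ = trans (length-φ-applyUpTo (h ∘ (k +_)) (3 * k)) (trans (*-assoc 3 k 6) (cong (3 *_) (sym (length-φ-applyUpTo h k))))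

pre5/4Power⇒echo : ∀ h n → IsPre5/4Power (applyUpTo h n) → ∃[ k ] 1 ≤ k × n ≡ 5 * k × Echo h k
pre5/4Power⇒echo h n (x , y , eq , ∣x∣≥1 , ∣y∣≡3∣x∣) = k , k≥1 , n≡5k , echo
  where
  five-parts : ∀ X → X + (3 * X + X) ≡ 5 * X
  five-parts = solve-∀
  n*6≡5∣x∣ : n * 6 ≡ 5 * length x
  n*6≡5∣x∣ = begin
    n * 6                                ≡⟨ length-φ-applyUpTo h n ⟨
    length (φ (applyUpTo h n))           ≡⟨ cong length eq ⟩
    length (x ++ y ++ x)                 ≡⟨ trans (List.length-++ x) (cong (length x +_) (List.length-++ y)) ⟩
    length x + (length y + length x)     ≡⟨ cong (λ Y → length x + (Y + length x)) ∣y∣≡3∣x∣ ⟩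
    length x + (3 * length x + length x) ≡⟨ five-parts (length x) ⟩
    5 * length x                         ∎
    where open ≡-Reasoning
  6∣∣x∣ : 6 ∣ length x
  6∣∣x∣ = coprime-divisor (toWitness {a? = coprime? 6 5} _) (divides n (sym n*6≡5∣x∣))
  k = quotient 6∣∣x∣
  ∣x∣≡k*6 : length x ≡ k * 6
  ∣x∣≡k*6 = equality 6∣∣x∣
  k≥1 : 1 ≤ k
  k≥1 = n≢0⇒n>0 λ k≡0 → n>0⇒n≢0 ∣x∣≥1 (trans ∣x∣≡k*6 (cong (_* 6) k≡0))
  n≡5k : n ≡ 5 * k
  n≡5k = *-cancelʳ-≡ n (5 * k) 6 (trans n*6≡5∣x∣ (trans (cong (5 *_) ∣x∣≡k*6) (sym (*-assoc 5 k 6))))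
  eq′ : applyUpTo (φω h) (n * 6) ≡ x ++ y ++ x
  eq′ = trans (sym (φ-applyUpTo h n)) eq
  copies : ∀ q → q < length x → φω h q ≡ φω h (length x + (length y + q))
  copies = applyUpTo-injective (length x) (trans (proj₁ (applyUpTo-split (φω h) _ x (y ++ x) eq′)) (sym last))
    where
    last : applyUpTo (φω h ∘ (length x +_) ∘ (length y +_)) (length x) ≡ x
    last = proj₂ (applyUpTo-split (φω h ∘ (length x +_)) _ y x (proj₂ (applyUpTo-split (φω h) _ x (y ++ x) eq′)))
  last-block : ∀ k i → k * 6 + (3 * (k * 6) + (i * 6 + 5)) ≡ (4 * k + i) * 6 + 5
  last-block = solve-∀
  echo : Echo h k
  echo i i<k = begin
    φlast (h i)                                ≡⟨ φω-position h (i , # 5) ⟨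
    φω h (i * 6 + 5)                           ≡⟨ copies (i * 6 + 5) (subst (i * 6 + 5 <_) (sym ∣x∣≡k*6) (position-< (# 5) i<k)) ⟩
    φω h (length x + (length y + (i * 6 + 5))) ≡⟨ cong (λ X → φω h (X + (length y + (i * 6 + 5)))) ∣x∣≡k*6 ⟩
    φω h (k * 6 + (length y + (i * 6 + 5)))    ≡⟨ cong (λ Y → φω h (k * 6 + (Y + (i * 6 + 5)))) (trans ∣y∣≡3∣x∣ (cong (3 *_) ∣x∣≡k*6)) ⟩
    φω h (k * 6 + (3 * (k * 6) + (i * 6 + 5))) ≡⟨ cong (φω h) (last-block k i) ⟩
    φω h ((4 * k + i) * 6 + 5)                 ≡⟨ φω-position h (4 * k + i , # 5) ⟩
    φlast (h (4 * k + i))                      ∎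
    where open ≡-Reasoning

-- Subscript states and the finite check

-- The state of a position of φ(w): the subscript of its block letter and its offset in the block.
State : Set
State = Fin 8 × Fin 6

succ₈ : Fin 8 → Fin 8
succ₈ j = suc (toℕ j) mod 8

Succ8⇒≡succ₈ : ∀ a b → Succ8 a b → sub b ≡ succ₈ (sub a)
Succ8⇒≡succ₈ _ _ eq = Fin.toℕ-injective (trans eq (sym (Fin.toℕ-fromℕ< _)))

next : State → State
next = tick succ₈

next-periodic : ∀ σ → fold σ next 48 ≡ σ
next-periodic (j , r) = from-yes (Fin.all? λ j → Fin.all? λ r → ≡-dec Fin._≟_ Fin._≟_ (fold (j , r) next 48) (j , r)) j r

next-4*-mod-12 : ∀ σ k i → fold σ next (4 * k + i) ≡ fold σ next (4 * (k % 12) + i)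
next-4*-mod-12 σ k i = begin
  fold σ next (4 * k + i)                                    ≡⟨ cong (λ k → fold σ next (4 * k + i)) (m≡m%n+[m/n]*n k 12) ⟩
  fold σ next (4 * (k % 12 + k / 12 * 12) + i)               ≡⟨ cong (fold σ next) (regroup (k % 12) (k / 12) i) ⟩
  fold σ next ((4 * (k % 12) + i) + k / 12 * 48)             ≡⟨ fold-+ σ next (4 * (k % 12) + i) ⟩
  fold (fold σ next (k / 12 * 48)) next (4 * (k % 12) + i)   ≡⟨ cong (λ τ → fold τ next (4 * (k % 12) + i)) (fold-*-invariant (λ τ → τ) next 48 next-periodic (k / 12) σ) ⟩
  fold σ next (4 * (k % 12) + i)                             ∎
  where
  open ≡-Reasoning
  regroup : ∀ m q i → 4 * (m + q * 12) + i ≡ (4 * m + i) + q * 48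
  regroup = solve-∀

lastSub : Fin 8 → Fin 8
lastSub j = sub (φlast (z0 , j))

sub-φlast : ∀ a → sub (φlast a) ≡ lastSub (sub a)
sub-φlast (n , j) = cong sub (φlast-+ₗ n j)

lastSub-periodic : ∀ j → lastSub (fold j succ₈ 4) ≡ lastSub j
lastSub-periodic = from-yes (Fin.all? λ j → lastSub (fold j succ₈ 4) Fin.≟ lastSub j)

_≟ₗ_ : DecidableEquality Letter
_≟ₗ_ = ≡-dec ℤ._≟_ Fin._≟_

open import Data.List.Membership.DecPropositional _≟ₗ_ using (_∈?_)

-- As a function of n, φlast of the letter at offset r of φ(n_j) is constant (r < 5) or a translate of n (r = 5).
data Profile : Set where
  fixed moving : Letter → Profile

_⟪_⟫ : Profile → ℤ → Letter
fixed ℓ  ⟪ n ⟫ = ℓ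
moving ℓ ⟪ n ⟫ = n +ₗ ℓ

profile : State → Profile
profile (j , r) with r Fin.≟ # 5
... | yes _ = moving (φlast (φlast (z0 , j)))
... | no _  = fixed (φlast (Vec.lookup (φᵥ (z0 , j)) r))

profile-sound : ∀ n j r → φlast (Vec.lookup (φᵥ (n , j)) r) ≡ profile (j , r) ⟪ n ⟫
profile-sound n j r with r Fin.≟ # 5
... | yes refl = φlast²-+ₗ n j
... | no r≢5   = cong φlast (φᵥ-fixed n j r r≢5)

Forces : State → State → Set
Forces (j , r) (j′ , r′) = ∀ n n′ → φlast (Vec.lookup (φᵥ (n , j)) r) ≡ φlast (Vec.lookup (φᵥ (n′ , j′)) r′) →
                           (n , j) ∈ Γ ⊎ (n′ , j′) ∈ Γ

-- The only n with n +ₗ ℓ ≡ ℓ′ is proj₁ ℓ′ - proj₁ ℓ.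
ShiftsIntoΓ : Fin 8 → Letter → Letter → Set
ShiftsIntoΓ j ℓ ℓ′ = sub ℓ ≢ sub ℓ′ ⊎ (proj₁ ℓ′ ℤ.- proj₁ ℓ , j) ∈ Γ

ShiftsIntoΓ-sound : ∀ {j ℓ ℓ′} → ShiftsIntoΓ j ℓ ℓ′ → ∀ n → n +ₗ ℓ ≡ ℓ′ → (n , j) ∈ Γ
ShiftsIntoΓ-sound (inj₁ ℓ≢ℓ′)          n eq = ⊥-elim (ℓ≢ℓ′ (cong sub eq))
ShiftsIntoΓ-sound {j} {ℓ} (inj₂ ∈Γ) n eq = subst (λ x → (x , j) ∈ Γ) (sym (x≈z//y n (proj₁ ℓ) _ (cong proj₁ eq))) ∈Γ

Separates : Profile → Profile → Fin 8 → Fin 8 → Set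
Separates (fixed ℓ)  (fixed ℓ′)  _ _  = ℓ ≢ ℓ′
Separates (fixed ℓ)  (moving ℓ′) _ j′ = ShiftsIntoΓ j′ ℓ′ ℓ
Separates (moving ℓ) (fixed ℓ′)  j _  = ShiftsIntoΓ j ℓ ℓ′
Separates (moving _) (moving _)  _ _  = ⊥

separates? : ∀ p p′ j j′ → Dec (Separates p p′ j j′)
separates? (fixed ℓ)  (fixed ℓ′)  _ _  = ¬? (ℓ ≟ₗ ℓ′)
separates? (fixed ℓ)  (moving ℓ′) _ j′ = ¬? (sub ℓ′ Fin.≟ sub ℓ) ⊎-dec (proj₁ ℓ ℤ.- proj₁ ℓ′ , j′) ∈? Γ
separates? (moving ℓ) (fixed ℓ′)  j _  = ¬? (sub ℓ Fin.≟ sub ℓ′) ⊎-dec (proj₁ ℓ′ ℤ.- proj₁ ℓ , j) ∈? Γ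
separates? (moving _) (moving _)  _ _  = no λ ()

Separates-sound : ∀ p p′ {j j′} → Separates p p′ j j′ → ∀ n n′ → p ⟪ n ⟫ ≡ p′ ⟪ n′ ⟫ → (n , j) ∈ Γ ⊎ (n′ , j′) ∈ Γ
Separates-sound (fixed ℓ)  (fixed ℓ′)  ℓ≢ℓ′ n n′ eq = ⊥-elim (ℓ≢ℓ′ eq)
Separates-sound (fixed ℓ)  (moving ℓ′) s    n n′ eq = inj₂ (ShiftsIntoΓ-sound s n′ (sym eq))
Separates-sound (moving ℓ) (fixed ℓ′)  s    n n′ eq = inj₁ (ShiftsIntoΓ-sound s n eq)

SeparatedStates : State → State → Set
SeparatedStates σ σ′ = Separates (profile σ) (profile σ′) (proj₁ σ) (proj₁ σ′)

SeparatedStates⇒Forces : ∀ σ σ′ → SeparatedStates σ σ′ → Forces σ σ′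
SeparatedStates⇒Forces (j , r) (j′ , r′) s n n′ eq =
  Separates-sound (profile (j , r)) (profile (j′ , r′)) s n n′ (trans (sym (profile-sound n j r)) (trans eq (profile-sound n′ j′ r′)))

SeparatedAt : ℕ → State → Set
SeparatedAt m σ = ∃ λ (i : Fin m) → SeparatedStates (fold σ next (toℕ i)) (fold σ next (4 * m + toℕ i))

separatedAt? : ∀ m σ → Dec (SeparatedAt m σ)
separatedAt? m σ = Fin.any? λ i → separates? _ _ _ _

-- Only 4k mod 48, that is k mod 12, matters; the multiples of 6 are handled by alignment.
-- Opaque: unfolding the exhaustive check when type-checking its uses is prohibitively slow.
opaque
  separated-mod-12 : ∀ (m : Fin 12) → toℕ m % 6 ≢ 0 → ∀ j r → SeparatedAt (toℕ m) (j , r)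
  separated-mod-12 = from-yes (Fin.all? {n = 12} λ m → ¬? (toℕ m % 6 ℕ.≟ 0) →-dec Fin.all? λ j → Fin.all? λ r → separatedAt? (toℕ m) (j , r))

-- Transfer of pre-5/4-power-freeness from a sequence to its image

module Transfer (g : ℕ → Letter) (N : ℕ)
  (increasing : ∀ c → suc c < N → Succ8 (g c) (g (suc c)))
  (avoids : ∀ c → c < N → g c ∉ Γ)
  (free : ∀ t n → t + n ≤ N → ¬ IsPre5/4Power (applyUpTo (g ∘ (t +_)) n))
  where

  subscript-+ : ∀ c n → c + n < N → sub (g (c + n)) ≡ fold (sub (g c)) succ₈ n
  subscript-+ c zero    _ = cong (sub ∘ g) (+-identityʳ c)
  subscript-+ c (suc n) c+1+n<N = begin
    sub (g (c + suc n))     ≡⟨ cong (sub ∘ g) (+-suc c n) ⟩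
    sub (g (suc (c + n)))   ≡⟨ Succ8⇒≡succ₈ (g (c + n)) (g (suc (c + n))) (increasing (c + n) (subst (_< N) (+-suc c n) c+1+n<N)) ⟩
    succ₈ (sub (g (c + n))) ≡⟨ cong succ₈ (subscript-+ c n (<-trans (+-monoʳ-< c (n<1+n n)) c+1+n<N)) ⟩
    succ₈ (fold (sub (g c)) succ₈ n) ∎
    where open ≡-Reasoning

  stateOf : Block → State
  stateOf (c , r) = sub (g c) , r

  stateAt : ℕ → State
  stateAt = stateOf ∘ blockOf

  stateOf-tick : ∀ b → proj₁ (tick suc b) < N → stateOf (tick suc b) ≡ next (stateOf b)
  stateOf-tick (c , 0F) _ = refl
  stateOf-tick (c , 1F) _ = refl
  stateOf-tick (c , 2F) _ = refl
  stateOf-tick (c , 3F) _ = refl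
  stateOf-tick (c , 4F) _ = refl
  stateOf-tick (c , 5F) c+1<N = cong (_, 0F) (Succ8⇒≡succ₈ (g c) (g (suc c)) (increasing c c+1<N))

  stateAt-+ : ∀ t n → t + n < N * 6 → stateAt (t + n) ≡ fold (stateAt t) next n
  stateAt-+ t zero    _ = cong stateAt (+-identityʳ t)
  stateAt-+ t (suc n) t+1+n<6N = begin
    stateAt (t + suc n)                  ≡⟨ cong stateAt (+-suc t n) ⟩
    stateOf (blockOf (suc (t + n)))      ≡⟨ cong stateOf (blockOf-suc (t + n)) ⟩
    stateOf (tick suc (blockOf (t + n))) ≡⟨ stateOf-tick (blockOf (t + n)) block<N ⟩
    next (stateAt (t + n))               ≡⟨ cong next (stateAt-+ t n (<-trans (+-monoʳ-< t (n<1+n n)) t+1+n<6N)) ⟩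
    next (fold (stateAt t) next n)       ∎
    where
    open ≡-Reasoning
    block<N : proj₁ (tick suc (blockOf (t + n))) < N
    block<N = subst (λ b → proj₁ b < N) (blockOf-suc (t + n)) (m<n*o⇒m/o<n (subst (_< N * 6) (+-suc t n) t+1+n<6N))

  -- When 6 divides the period, the echo compares last letters of blocks whose subscripts differ by a
  -- multiple of 4, so by φlast-injective it is an echo of g itself.
  aligned : ∀ t m → 1 ≤ m → t + 5 * (m * 6) ≤ N * 6 → ¬ Echo (φω g ∘ (t +_)) (m * 6)
  aligned t m m≥1 t+30m≤6N echo = free c (5 * m) c+5m≤N (echo⇒pre5/4Power (g ∘ (c +_)) m m≥1 block-echo)
    where
    c = t / 6
    r = toℕ (t mod 6)
    t≡c*6+r : t ≡ c * 6 + r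
    t≡c*6+r = sym (position-blockOf t)
    d = 5 ∸ r
    r+d≡5 : r + d ≡ 5
    r+d≡5 = m+[n∸m]≡n (ℕ.s≤s⁻¹ (Fin.toℕ<n (t mod 6)))
    c+5m≤N : c + 5 * m ≤ N
    c+5m≤N = *-cancelʳ-≤ (c + 5 * m) N 6 (begin
      (c + 5 * m) * 6        ≡⟨ *-distribʳ-+ 6 c (5 * m) ⟩
      c * 6 + 5 * m * 6      ≡⟨ cong (c * 6 +_) (*-assoc 5 m 6) ⟩
      c * 6 + 5 * (m * 6)    ≤⟨ +-monoˡ-≤ (5 * (m * 6)) (m≤m+n (c * 6) r) ⟩
      c * 6 + r + 5 * (m * 6) ≡⟨ cong (_+ 5 * (m * 6)) t≡c*6+r ⟨
      t + 5 * (m * 6)        ≤⟨ t+30m≤6N ⟩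
      N * 6                  ∎)
      where open ≤-Reasoning
    first-copy : ∀ i → t + (i * 6 + d) ≡ position (c + i , # 5)
    first-copy i = trans (cong (_+ (i * 6 + d)) t≡c*6+r) (trans (regroup c r i d) (cong ((c + i) * 6 +_) r+d≡5))
      where
      regroup : ∀ c r i d → c * 6 + r + (i * 6 + d) ≡ (c + i) * 6 + (r + d)
      regroup = solve-∀
    second-copy : ∀ i → t + (4 * (m * 6) + (i * 6 + d)) ≡ position (c + (4 * m + i) , # 5)
    second-copy i = trans (cong (_+ (4 * (m * 6) + (i * 6 + d))) t≡c*6+r) (trans (regroup c r m i d) (cong ((c + (4 * m + i)) * 6 +_) r+d≡5))
      where
      regroup : ∀ c r m i d → c * 6 + r + (4 * (m * 6) + (i * 6 + d)) ≡ (c + (4 * m + i)) * 6 + (r + d)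
      regroup = solve-∀
    same-subscript : ∀ i → i < m → sub (φlast (g (c + i))) ≡ sub (φlast (g (c + (4 * m + i))))
    same-subscript i i<m = begin
      sub (φlast (g (c + i)))                         ≡⟨ sub-φlast (g (c + i)) ⟩
      lastSub (sub (g (c + i)))                       ≡⟨ fold-*-invariant lastSub succ₈ 4 lastSub-periodic m _ ⟨
      lastSub (fold (sub (g (c + i))) succ₈ (m * 4))  ≡⟨ cong lastSub (subscript-+ (c + i) (m * 4) c+i+4m<N) ⟨
      lastSub (sub (g (c + i + m * 4)))               ≡⟨ cong (lastSub ∘ sub ∘ g) (regroup c i m) ⟩
      lastSub (sub (g (c + (4 * m + i))))             ≡⟨ sub-φlast (g (c + (4 * m + i))) ⟨
      sub (φlast (g (c + (4 * m + i))))               ∎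
      where
      open ≡-Reasoning
      regroup : ∀ c i m → c + i + m * 4 ≡ c + (4 * m + i)
      regroup = solve-∀
      c+i+4m<N : c + i + m * 4 < N
      c+i+4m<N = subst (_< N) (sym (regroup c i m))
        (<-≤-trans (+-monoʳ-< c (subst (4 * m + i <_) (+-comm (4 * m) m) (+-monoʳ-< (4 * m) i<m))) c+5m≤N)
    block-echo : Echo (g ∘ (c +_)) m
    block-echo i i<m = φlast-injective (same-subscript i i<m) (begin
      φlast (φlast (g (c + i)))                        ≡⟨ cong φlast (φω-position g (c + i , # 5)) ⟨
      φlast (φω g (position (c + i , # 5)))            ≡⟨ cong (φlast ∘ φω g) (first-copy i) ⟨
      φlast (φω g (t + (i * 6 + d)))                   ≡⟨ echo (i * 6 + d) (≤-<-trans (+-monoʳ-≤ (i * 6) (m∸n≤m 5 r)) (position-< (# 5) i<m)) ⟩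
      φlast (φω g (t + (4 * (m * 6) + (i * 6 + d))))   ≡⟨ cong (φlast ∘ φω g) (second-copy i) ⟩
      φlast (φω g (position (c + (4 * m + i) , # 5)))  ≡⟨ cong φlast (φω-position g (c + (4 * m + i) , # 5)) ⟩
      φlast (φlast (g (c + (4 * m + i))))              ∎)
      where open ≡-Reasoning

  unaligned : ∀ t k → k % 6 ≢ 0 → t + 5 * k ≤ N * 6 → ¬ Echo (φω g ∘ (t +_)) k
  unaligned t k k%6≢0 t+5k≤6N echo =
    [ avoids (p / 6) (block< p<6N) , avoids (p′ / 6) (block< p′<6N) ]′ (forced (echo i₀ i₀<k))
    where
    σ = stateAt t
    M = k mod 12
    toℕM≡k%12 : toℕ M ≡ k % 12
    toℕM≡k%12 = Fin.toℕ-fromℕ< (m%n<n k 12)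
    M%6≢0 : toℕ M % 6 ≢ 0
    M%6≢0 = k%6≢0 ∘ trans (sym (m∣n⇒o%n%m≡o%m 6 12 k (divides 2 refl))) ∘ subst (λ x → x % 6 ≡ 0) toℕM≡k%12
    separating : SeparatedAt (toℕ M) σ
    separating = separated-mod-12 M M%6≢0 (proj₁ σ) (proj₂ σ)
    i₀ = toℕ (proj₁ separating)
    i₀<k : i₀ < k
    i₀<k = <-≤-trans (Fin.toℕ<n (proj₁ separating)) (subst (_≤ k) (sym toℕM≡k%12) (m%n≤m k 12))
    p = t + i₀
    p′ = t + (4 * k + i₀)
    window< : ∀ j → j < 5 * k → t + j < N * 6
    window< j j<5k = <-≤-trans (+-monoʳ-< t j<5k) t+5k≤6N
    p<6N : p < N * 6
    p<6N = window< i₀ (<-≤-trans i₀<k (m≤m+n k (4 * k)))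
    p′<6N : p′ < N * 6
    p′<6N = window< (4 * k + i₀) (subst (4 * k + i₀ <_) (+-comm (4 * k) k) (+-monoʳ-< (4 * k) i₀<k))
    block< : ∀ {q} → q < N * 6 → q / 6 < N
    block< = m<n*o⇒m/o<n
    state-p : stateAt p ≡ fold σ next i₀
    state-p = stateAt-+ t i₀ p<6N
    state-p′ : stateAt p′ ≡ fold σ next (4 * toℕ M + i₀)
    state-p′ = trans (stateAt-+ t (4 * k + i₀) p′<6N)
                     (trans (next-4*-mod-12 σ k i₀) (cong (λ m → fold σ next (4 * m + i₀)) (sym toℕM≡k%12)))
    forced : φlast (φω g p) ≡ φlast (φω g p′) → g (p / 6) ∈ Γ ⊎ g (p′ / 6) ∈ Γ
    forced = SeparatedStates⇒Forces (stateAt p) (stateAt p′) (subst₂ SeparatedStates (sym state-p) (sym state-p′) (proj₂ separating)) _ _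

  φω-echo-free : ∀ t k → 1 ≤ k → t + 5 * k ≤ N * 6 → ¬ Echo (φω g ∘ (t +_)) k
  φω-echo-free t k k≥1 t+5k≤6N with k % 6 ℕ.≟ 0
  ... | no k%6≢0  = unaligned t k k%6≢0 t+5k≤6N
  ... | yes k%6≡0 = subst (λ k → t + 5 * k ≤ N * 6 → ¬ Echo (φω g ∘ (t +_)) k) (sym k≡m*6) (aligned t m m≥1) t+5k≤6N
    where
    m = k / 6
    k≡m*6 : k ≡ m * 6
    k≡m*6 = trans (m≡m%n+[m/n]*n k 6) (cong (_+ m * 6) k%6≡0)
    m≥1 : 1 ≤ m
    m≥1 = n≢0⇒n>0 λ m≡0 → n>0⇒n≢0 k≥1 (trans k≡m*6 (cong (_* 6) m≡0))

  φω-windows-free : ∀ t n → t + n ≤ N * 6 → ¬ IsPre5/4Power (applyUpTo (φω g ∘ (t +_)) n)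
  φω-windows-free t n t+n≤6N pre =
    let k , k≥1 , n≡5k , echo = pre5/4Power⇒echo (φω g ∘ (t +_)) n pre
    in φω-echo-free t k k≥1 (subst (λ n → t + n ≤ N * 6) n≡5k t+n≤6N) echo

-- Positions past the end read a junk letter; only positions below the length are ever used.
at : Word → ℕ → Letter
at []      _       = z0 , 0F
at (a ∷ _) zero    = a
at (_ ∷ w) (suc i) = at w i

applyUpTo-at : ∀ w → applyUpTo (at w) (length w) ≡ w
applyUpTo-at []      = refl
applyUpTo-at (a ∷ w) = cong (a ∷_) (applyUpTo-at w)

All-at : ∀ {P : Letter → Set} {w} → All P w → ∀ c → c < length w → P (at w c)
All-at (pa ∷ _)   zero    _         = pa
All-at (_  ∷ all) (suc c) (s≤s c<n) = All-at all c c<n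

Linked-at : ∀ {R : Letter → Letter → Set} {w} → Linked R w → ∀ c → suc c < length w → R (at w c) (at w (suc c))
Linked-at (r ∷ _)      zero    _           = r
Linked-at (_ ∷ linked) (suc c) (s≤s 2+c<n) = Linked-at linked c 2+c<n
Linked-at [-]          zero    (s≤s ())

window-factor : ∀ w t n → t + n ≤ length w → Factor (applyUpTo (at w ∘ (t +_)) n) w
window-factor w t n t+n≤∣w∣ = applyUpTo (at w) t , applyUpTo (λ i → at w (t + (n + i))) rest , (begin
  w                                                                 ≡⟨ applyUpTo-at w ⟨
  applyUpTo (at w) (length w)                                       ≡⟨ cong (applyUpTo (at w)) ∣w∣≡t+[n+rest] ⟩
  applyUpTo (at w) (t + (n + rest))                                 ≡⟨ applyUpTo-++ (at w) t (n + rest) ⟩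
  applyUpTo (at w) t ++ applyUpTo (at w ∘ (t +_)) (n + rest)        ≡⟨ cong (applyUpTo (at w) t ++_) (applyUpTo-++ (at w ∘ (t +_)) n rest) ⟩
  applyUpTo (at w) t ++ applyUpTo (at w ∘ (t +_)) n ++ applyUpTo (λ i → at w (t + (n + i))) rest ∎)
  where
  open ≡-Reasoning
  rest = length w ∸ (t + n)
  ∣w∣≡t+[n+rest] : length w ≡ t + (n + rest)
  ∣w∣≡t+[n+rest] = trans (sym (m+[n∸m]≡n t+n≤∣w∣)) (+-assoc t n rest)

window-factorω : ∀ s t n → Factorω (applyUpTo (s ∘ (t +_)) n) s
window-factorω s t n = t , trans (sym (List.map-upTo (s ∘ (t +_)) n)) (cong (segment s t) (sym (List.length-applyUpTo _ n)))

proposition4p7 : ((w : Word) → SubscriptIncreasing w → AvoidsΓ w → Pre5/4PowerFree w → Pre5/4PowerFree (φ w))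
                 × ((s : ωWord) → SubscriptIncreasingω s → AvoidsΓω s → Pre5/4PowerFreeω s → Pre5/4PowerFreeω (φω s))
proposition4p7 = finite , infinite
  where
  finite : (w : Word) → SubscriptIncreasing w → AvoidsΓ w → Pre5/4PowerFree w → Pre5/4PowerFree (φ w)
  finite w increasing avoids free v (p , q , φw≡pvq) =
    subst (¬_ ∘ IsPre5/4Power) v-window
      (Transfer.φω-windows-free (at w) (length w) (Linked-at increasing) (All-at avoids)
        (λ t n t+n≤∣w∣ → free _ (window-factor w t n t+n≤∣w∣)) (length p) (length v) v-in-range)
    where
    φw-window : applyUpTo (φω (at w)) (length w * 6) ≡ p ++ v ++ q
    φw-window = trans (sym (φ-applyUpTo (at w) (length w))) (trans (cong φ (applyUpTo-at w)) φw≡pvq)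
    v-window : applyUpTo (φω (at w) ∘ (length p +_)) (length v) ≡ v
    v-window = proj₁ (applyUpTo-factor (φω (at w)) _ p v q φw-window)
    v-in-range : length p + length v ≤ length w * 6
    v-in-range = proj₂ (applyUpTo-factor (φω (at w)) _ p v q φw-window)

  infinite : (s : ωWord) → SubscriptIncreasingω s → AvoidsΓω s → Pre5/4PowerFreeω s → Pre5/4PowerFreeω (φω s)
  infinite s increasing avoids free v (t , v≡segment) =
    subst (¬_ ∘ IsPre5/4Power) (sym (trans v≡segment (List.map-upTo (φω s ∘ (t +_)) (length v))))
      (Transfer.φω-windows-free s (t + length v) (λ c _ → increasing c) (λ c _ → avoids c)
        (λ t′ n _ → free _ (window-factorω s t′ n)) t (length v) (m≤m*n (t + length v) 6))
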